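{- Let $r,s$ be coprime positive integers with $s=tr+1$ for some integer $t\ge0$. Then for every $n\ge0$ there exists a bijection $\phi:Q_n^{r/s}\to\widetilde R_{n+t+1}^{r/s}$.
   Context: Let $\mathcal D$ be the set of Dyck paths of height at most $2$: words over $\{U,D\}$ ($U=(1,1)$, $D=(1,-1)$) from $(0,0)$ to $(2n,0)$ never going below the $x$-axis and whose $U$ steps reach ordinate at most $2$; $n$ is the semilength, and the empty path $\varepsilon$ has semilength $0$. Every nonempty $P\in\mathcal D$ has the form $UwD$ where $w$ is a word in the factors $UD$ and $DU$; grouping $w$ into maximal runs gives the factorization $P=U(UD)^{p_1}(DU)^{v_1}(UD)^{p_2}(DU)^{v_2}\cdots(UD)^{p_k}(DU)^{v_k}D$, where $p_1\ge0$ and $v_k\ge0$ may be zero and all other exponents are positive; for $P=UD$ one has $k=0$. $\widetilde R_n^{r/s}$ is the set of paths $P\in\mathcal D$ of semilength $n$ such that, for every $i=1,\dots,k$, $p_i\le r$ and $v_i\ge\lceil p_i s/r\rceil$. $Q_n^{r/s}$ is the set of paths $P\in\mathcal D$ of semilength $n$ such that: $p_i\le r$ for all $i=1,\dots,k$; $v_i\ge\lceil p_i s/r\rceil$ for $i=1,\dots,k-1$; and for $i=k$: if $p_k=r$ then $v_k\ge0$ is arbitrary, while if $p_k<r$ then either $v_k=0$ or $v_k\ge\lceil p_k s/r\rceil$. (Both sets contain $\varepsilon$ for $n=0$.) -}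

module Defs where

open import Data.Nat using (ℕ; zero; suc; _+_; _*_; _∸_; _≤_; _<_; NonZero)
open import Data.Nat.DivMod using (_/_)
open import Data.List using (List; []; _∷_; _++_; length; concat; replicate)
open import Data.List.Relation.Unary.All using (All)
open import Data.Product using (Σ; _×_; _,_; ∃)
open import Data.Sum using (_⊎_)
open import Data.Unit using (⊤)
open import Data.Empty using (⊥)
open import Relation.Binary.PropositionalEquality using (_≡_)

-- Steps: U = (1,1), D = (1,-1)
data Step : Set where
  U D : Step

PathFrom : ℕ → List Step → Set
PathFrom zero    []      = ⊤
PathFrom (suc h) []      = ⊥
PathFrom h       (U ∷ w) = (suc h ≤ 2) × PathFrom (suc h) w
PathFrom zero    (D ∷ w) = ⊥
PathFrom (suc h) (D ∷ w) = PathFrom h w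

IsDyck≤2 : List Step → Set
IsDyck≤2 w = PathFrom 0 w

HasSemilength : ℕ → List Step → Set
HasSemilength n w = length w ≡ 2 * n

⌈_/_⌉ : ℕ → (r : ℕ) → .{{NonZero r}} → ℕ
⌈ a / r ⌉ = (a + (r ∸ 1)) / r

Fact : Set
Fact = List (ℕ × ℕ)

-- the path U (UD)^{p₁}(DU)^{v₁}⋯(UD)^{p_k}(DU)^{v_k} D
body : Fact → List Step
body []             = []
body ((p , v) ∷ fs) =
  concat (replicate p (U ∷ D ∷ [])) ++ concat (replicate v (D ∷ U ∷ [])) ++ body fs

encode : Fact → List Step
encode fs = U ∷ (body fs ++ (D ∷ []))

-- Maximal-run conditions: p₁ ≥ 0 and v_k ≥ 0, all other exponents positive
-- (and no pair is (0,0), which makes k = 0 for UD and the factorization unique).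
ValidTail : Fact → Set
ValidTail []             = ⊤
ValidTail ((p , v) ∷ []) = 1 ≤ p
ValidTail ((p , v) ∷ fs@(_ ∷ _)) = (1 ≤ p) × (1 ≤ v) × ValidTail fs

ValidFact : Fact → Set
ValidFact []                        = ⊤
ValidFact ((p , v) ∷ [])            = 1 ≤ p + v
ValidFact ((p , v) ∷ fs@(_ ∷ _))    = (1 ≤ v) × ValidTail fs

RCond : (r s : ℕ) → .{{NonZero r}} → Fact → Set
RCond r s fs = All (λ { (p , v) → (p ≤ r) × (⌈ p * s / r ⌉ ≤ v) }) fs

LastQ : (r s : ℕ) → .{{NonZero r}} → ℕ × ℕ → Set
LastQ r s (p , v) = (p ≤ r) × ((p ≡ r) ⊎ ((p < r) × ((v ≡ 0) ⊎ (⌈ p * s / r ⌉ ≤ v))))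

QCond : (r s : ℕ) → .{{NonZero r}} → Fact → Set
QCond r s []                    = ⊤
QCond r s (pv ∷ [])             = LastQ r s pv
QCond r s (pv ∷ fs@(_ ∷ _))     = RCond r s (pv ∷ []) × QCond r s fs

InR : (r s : ℕ) → .{{NonZero r}} → ℕ → List Step → Set
InR r s n P = IsDyck≤2 P × HasSemilength n P ×
  ((P ≡ []) ⊎ Σ Fact (λ fs → ValidFact fs × (P ≡ encode fs) × RCond r s fs))

InQ : (r s : ℕ) → .{{NonZero r}} → ℕ → List Step → Set
InQ r s n P = IsDyck≤2 P × HasSemilength n P ×
  ((P ≡ []) ⊎ Σ Fact (λ fs → ValidFact fs × (P ≡ encode fs) × QCond r s fs))

Bijection : (List Step → Set) → (List Step → Set) → Set
Bijection A B = Σ (List Step → List Step) λ φ →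
  (∀ P → A P → B (φ P)) ×
  (∀ P P' → A P → A P' → φ P ≡ φ P' → P ≡ P') ×
  (∀ Q → B Q → Σ (List Step) λ P → A P × (φ P ≡ Q))

-- Only the last pair (p_k , v_k) of the factorization changes, and p_k + v_k grows by T = t + 1.
-- Since s = t r + 1, the threshold ⌈ p s / r ⌉ equals need p = p t + 1 for 0 < p ≤ r (and 0 for p = 0).
-- A last pair with v ≥ need p is sent to (p , v + T).  The other last pairs allowed in Q, namely
-- (r , v) with v ≤ r t and (p , 0) with 0 < p < r, are indexed by p - 1 + v ∈ [0, r T); so are the
-- pairs (q , w) of R̃ with need q ≤ w < need q + T, through m ↦ (m / T + 1 , need (m / T + 1) + m mod T),
-- and matching the indices completes the bijection on last pairs.  The empty path and UD, which have
-- no last pair, go to U (DU)^t D and U (DU)^(t+1) D.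

module Submission where

open import Defs
open import Data.Nat using (ℕ; zero; suc; pred; _+_; _*_; _∸_; _≤_; _<_; z≤n; s≤s; NonZero)
open import Data.Nat.Properties
open import Data.Nat.Coprimality using (Coprime)
open import Data.Nat.DivMod using (_/_; _%_; m≡m%n+[m/n]*n; m%n<n; +-distrib-/-∣ʳ; m<n⇒m%n≡m; m<n⇒m/n≡0; m*n/n≡m; [m+kn]%n≡m%n; m<n*o⇒m/o<n)
open import Data.Nat.Divisibility using (n∣m*n)
open import Data.Nat.ListAction using (sum)
open import Data.Nat.Tactic.RingSolver using (solve-∀)
open import Data.List using (List; []; _∷_; _++_; length; concat; replicate; map)
open import Data.List.Properties using (++-assoc; length-++; ∷-injectiveˡ; ∷-injectiveʳ)
open import Data.List.Relation.Unary.All using ([]; _∷_)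
open import Data.Maybe using (Maybe; nothing; just)
open import Data.Maybe.Properties using (just-injective)
open import Data.Product using (Σ; _×_; _,_; proj₁)
open import Data.Unit using (⊤; tt)
open import Data.Sum using (_⊎_; inj₁; inj₂)
open import Function using (_∘_)
open import Relation.Nullary using (¬_; yes; no; contradiction)
open import Relation.Binary.PropositionalEquality

Pair : Set
Pair = ℕ × ℕ

total : Pair → ℕ
total (p , v) = p + v

-- Semilength of encode fs, minus one.
size : Fact → ℕ
size fs = sum (map total fs)

UD^_ DU^_ : ℕ → List Step
UD^ p = concat (replicate p (U ∷ D ∷ []))
DU^ v = concat (replicate v (D ∷ U ∷ []))

column : ℕ → Fact
column zero    = []
column (suc v) = (0 , suc v) ∷ []

column-ValidFact : ∀ v → ValidFact (column v)
column-ValidFact zero    = tt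
column-ValidFact (suc v) = s≤s z≤n

size-column : ∀ v → size (column v) ≡ v
size-column zero    = refl
size-column (suc v) = +-identityʳ (suc v)

HeadPositive : Fact → Set
HeadPositive []            = ⊤
HeadPositive ((p , _) ∷ _) = 1 ≤ p

ValidTail⇒HeadPositive : ∀ {fs} → ValidTail fs → HeadPositive fs
ValidTail⇒HeadPositive {[]}              _         = tt
ValidTail⇒HeadPositive {_ ∷ []}          1≤p       = 1≤p
ValidTail⇒HeadPositive {_ ∷ _ ∷ _}       (1≤p , _) = 1≤p

ValidTail⇒ValidFact : ∀ {fs} → ValidTail fs → ValidFact fs
ValidTail⇒ValidFact {[]}                  _             = tt
ValidTail⇒ValidFact {(p , v) ∷ []}        1≤p           = ≤-trans 1≤p (m≤m+n p v)
ValidTail⇒ValidFact {_ ∷ _ ∷ _}           (_ , 1≤v , tail) = 1≤v , tail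

ValidFact⇒size-pos : ∀ {x xs} → ValidFact (x ∷ xs) → 1 ≤ size (x ∷ xs)
ValidFact⇒size-pos {p , v} {[]}    1≤p+v     = ≤-trans 1≤p+v (m≤m+n (p + v) 0)
ValidFact⇒size-pos {p , v} {_ ∷ _} (1≤v , _) =
  ≤-trans 1≤v (≤-trans (m≤n+m v p) (m≤m+n (p + v) _))

pushUD : Fact → Fact
pushUD []             = (1 , 0) ∷ []
pushUD ((p , v) ∷ fs) = (suc p , v) ∷ fs

pushDU : Fact → Fact
pushDU []                     = (0 , 1) ∷ []
pushDU ((zero , v) ∷ fs)      = (0 , suc v) ∷ fs
pushDU fs@((suc _ , _) ∷ _)   = (0 , 1) ∷ fs

decodeBody : List Step → Fact
decodeBody (U ∷ D ∷ w) = pushUD (decodeBody w)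
decodeBody (D ∷ U ∷ w) = pushDU (decodeBody w)
decodeBody _           = []

decodeBody-UD^ : ∀ p v fs w → decodeBody w ≡ (0 , v) ∷ fs →
                 decodeBody (UD^ p ++ w) ≡ (p , v) ∷ fs
decodeBody-UD^ zero    v fs w eq = eq
decodeBody-UD^ (suc p) v fs w eq = cong pushUD (decodeBody-UD^ p v fs w eq)

decodeBody-UD^-end : ∀ p w → decodeBody w ≡ [] →
                     decodeBody (UD^ suc p ++ w) ≡ (suc p , 0) ∷ []
decodeBody-UD^-end zero    w eq = cong pushUD eq
decodeBody-UD^-end (suc p) w eq = cong pushUD (decodeBody-UD^-end p w eq)

decodeBody-DU^ : ∀ v fs w → HeadPositive fs → decodeBody w ≡ fs →
                 decodeBody (DU^ suc v ++ w) ≡ (0 , suc v) ∷ fs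
decodeBody-DU^ zero    []                  w _   eq = cong pushDU eq
decodeBody-DU^ zero    ((suc p , u) ∷ fs)  w _   eq = cong pushDU eq
decodeBody-DU^ (suc v) fs                  w pos eq = cong pushDU (decodeBody-DU^ v fs w pos eq)

body-∷-++ : ∀ p v fs w → body ((p , v) ∷ fs) ++ w ≡ UD^ p ++ DU^ v ++ body fs ++ w
body-∷-++ p v fs w = trans (++-assoc (UD^ p) _ w) (cong (UD^ p ++_) (++-assoc (DU^ v) (body fs) w))

decodeBody-body : ∀ {fs} → ValidFact fs → decodeBody (body fs ++ D ∷ []) ≡ fs
decodeBody-body {[]} _ = refl
decodeBody-body {(suc p , zero) ∷ []} _ =
  trans (cong decodeBody (body-∷-++ (suc p) 0 [] _)) (decodeBody-UD^-end p _ refl)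
decodeBody-body {(p , suc v) ∷ []} _ =
  trans (cong decodeBody (body-∷-++ p (suc v) [] _)) (decodeBody-UD^ p _ _ _ (decodeBody-DU^ v [] _ tt refl))
decodeBody-body {(p , suc v) ∷ fs@(_ ∷ _)} (_ , tail) =
  trans (cong decodeBody (body-∷-++ p (suc v) fs _))
        (decodeBody-UD^ p _ _ _ (decodeBody-DU^ v fs _ (ValidTail⇒HeadPositive tail)
                                   (decodeBody-body (ValidTail⇒ValidFact tail))))

decode : List Step → Maybe Fact
decode []      = nothing
decode (_ ∷ w) = just (decodeBody w)

decode-encode : ∀ {fs} → ValidFact fs → decode (encode fs) ≡ just fs
decode-encode vf = cong just (decodeBody-body vf)

encode-injective : ∀ {fs gs} → ValidFact fs → ValidFact gs → encode fs ≡ encode gs → fs ≡ gs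
encode-injective vf vg eq =
  just-injective (trans (sym (decode-encode vf)) (trans (cong decode eq) (decode-encode vg)))

length-UD^ : ∀ p → length (UD^ p) ≡ 2 * p
length-UD^ zero    = refl
length-UD^ (suc p) = trans (cong (suc ∘ suc) (length-UD^ p)) (sym (*-suc 2 p))

length-DU^ : ∀ v → length (DU^ v) ≡ 2 * v
length-DU^ zero    = refl
length-DU^ (suc v) = trans (cong (suc ∘ suc) (length-DU^ v)) (sym (*-suc 2 v))

length-body : ∀ fs → length (body fs) ≡ 2 * size fs
length-body []             = refl
length-body ((p , v) ∷ fs) = begin
  length (UD^ p ++ DU^ v ++ body fs)                ≡⟨ length-++ (UD^ p) ⟩
  length (UD^ p) + length (DU^ v ++ body fs)        ≡⟨ cong (length (UD^ p) +_) (length-++ (DU^ v)) ⟩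
  length (UD^ p) + (length (DU^ v) + length (body fs))
    ≡⟨ cong₂ _+_ (length-UD^ p) (cong₂ _+_ (length-DU^ v) (length-body fs)) ⟩
  2 * p + (2 * v + 2 * size fs)                     ≡⟨ cong (2 * p +_) (*-distribˡ-+ 2 v (size fs)) ⟨
  2 * p + 2 * (v + size fs)                         ≡⟨ *-distribˡ-+ 2 p (v + size fs) ⟨
  2 * (p + (v + size fs))                           ≡⟨ cong (2 *_) (+-assoc p v (size fs)) ⟨
  2 * size ((p , v) ∷ fs)                           ∎
  where open ≡-Reasoning

length-encode : ∀ fs → length (encode fs) ≡ 2 * suc (size fs)
length-encode fs = begin
  suc (length (body fs ++ D ∷ []))  ≡⟨ cong suc (length-++ (body fs)) ⟩
  suc (length (body fs) + 1)        ≡⟨ cong suc (+-comm (length (body fs)) 1) ⟩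
  suc (suc (length (body fs)))      ≡⟨ cong (suc ∘ suc) (length-body fs) ⟩
  suc (suc (2 * size fs))           ≡⟨ *-suc 2 (size fs) ⟨
  2 * suc (size fs)                 ∎
  where open ≡-Reasoning

PathFrom1-UD^ : ∀ p {w} → PathFrom 1 w → PathFrom 1 (UD^ p ++ w)
PathFrom1-UD^ zero    h = h
PathFrom1-UD^ (suc p) h = s≤s (s≤s z≤n) , PathFrom1-UD^ p h

PathFrom1-DU^ : ∀ v {w} → PathFrom 1 w → PathFrom 1 (DU^ v ++ w)
PathFrom1-DU^ zero    h = h
PathFrom1-DU^ (suc v) h = s≤s z≤n , PathFrom1-DU^ v h

PathFrom1-body : ∀ fs {w} → PathFrom 1 w → PathFrom 1 (body fs ++ w)
PathFrom1-body []             h = h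
PathFrom1-body ((p , v) ∷ fs) h =
  subst (PathFrom 1) (sym (body-∷-++ p v fs _))
        (PathFrom1-UD^ p (PathFrom1-DU^ v (PathFrom1-body fs h)))

encode-IsDyck≤2 : ∀ fs → IsDyck≤2 (encode fs)
encode-IsDyck≤2 fs = s≤s z≤n , PathFrom1-body fs tt

Paths : (Fact → Set) → ℕ → List Step → Set
Paths C n P = IsDyck≤2 P × HasSemilength n P ×
  ((P ≡ []) ⊎ Σ Fact (λ fs → ValidFact fs × (P ≡ encode fs) × C fs))

encodeCode : Maybe Fact → List Step
encodeCode nothing   = []
encodeCode (just fs) = encode fs

codeSize : Maybe Fact → ℕ
codeSize nothing   = 0
codeSize (just fs) = suc (size fs)

ValidCode : (Fact → Set) → Maybe Fact → Set
ValidCode C nothing   = ⊤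
ValidCode C (just fs) = ValidFact fs × C fs

Code : (Fact → Set) → ℕ → Maybe Fact → Set
Code C n c = ValidCode C c × codeSize c ≡ n

decode-encodeCode : ∀ {C c} → ValidCode C c → decode (encodeCode c) ≡ c
decode-encodeCode {c = nothing} _        = refl
decode-encodeCode {c = just _}  (vf , _) = decode-encode vf

Paths⇒Code : ∀ {C n P} → Paths C n P → Σ (Maybe Fact) λ c → Code C n c × P ≡ encodeCode c
Paths⇒Code {n = n} (_ , len , inj₁ refl) = nothing , (tt , *-cancelˡ-≡ 0 n 2 len) , refl
Paths⇒Code {n = n} (_ , len , inj₂ (fs , vf , refl , cf)) =
  just fs , ((vf , cf) , *-cancelˡ-≡ (suc (size fs)) n 2 (trans (sym (length-encode fs)) len)) , refl

Code⇒Paths : ∀ {C n c} → Code C n c → Paths C n (encodeCode c)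
Code⇒Paths {c = nothing}  (_ , refl)         = tt , refl , inj₁ refl
Code⇒Paths {c = just fs}  ((vf , cf) , refl) = encode-IsDyck≤2 fs , length-encode fs , inj₂ (fs , vf , refl , cf)

record CodeBijection (A : Fact → Set) (n : ℕ) (B : Fact → Set) (m : ℕ) : Set where
  field
    to           : Maybe Fact → Fact
    to-code      : ∀ {c} → Code A n c → Code B m (just (to c))
    to-injective : ∀ {c c′} → Code A n c → Code A n c′ → to c ≡ to c′ → c ≡ c′
    to-onto      : ∀ {gs} → Code B m (just gs) → Σ (Maybe Fact) λ c → Code A n c × to c ≡ gs

CodeBijection⇒Bijection : ∀ {A n B m} → m ≢ 0 → CodeBijection A n B m → Bijection (Paths A n) (Paths B m)
CodeBijection⇒Bijection {A} {n} {B} {m} m≢0 cb = φ , into , injective , onto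
  where
  open CodeBijection cb

  φ : List Step → List Step
  φ P = encode (to (decode P))

  φ-encodeCode : ∀ {c} → Code A n c → φ (encodeCode c) ≡ encode (to c)
  φ-encodeCode (vc , _) = cong (encode ∘ to) (decode-encodeCode vc)

  into : ∀ P → Paths A n P → Paths B m (φ P)
  into P p with Paths⇒Code p
  ... | c , code , refl = subst (Paths B m) (sym (φ-encodeCode code)) (Code⇒Paths (to-code code))

  injective : ∀ P P′ → Paths A n P → Paths A n P′ → φ P ≡ φ P′ → P ≡ P′
  injective P P′ p p′ eq with Paths⇒Code p | Paths⇒Code p′
  ... | c , code , refl | c′ , code′ , refl =
    cong encodeCode (to-injective code code′
      (encode-injective (proj₁ (proj₁ (to-code code))) (proj₁ (proj₁ (to-code code′)))
        (trans (sym (φ-encodeCode code)) (trans eq (φ-encodeCode code′)))))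

  onto : ∀ Q → Paths B m Q → Σ (List Step) λ P → Paths A n P × φ P ≡ Q
  onto Q q with Paths⇒Code q
  ... | nothing , (_ , m≡0) , _  = contradiction (sym m≡0) m≢0
  ... | just gs , code , refl with to-onto code
  ...   | c , codeA , refl = encodeCode c , Code⇒Paths codeA , φ-encodeCode codeA

[m+kn]/n≡k : ∀ {m} k n .{{_ : NonZero n}} → m < n → (m + k * n) / n ≡ k
[m+kn]/n≡k {m} k n m<n = begin
  (m + k * n) / n      ≡⟨ +-distrib-/-∣ʳ m (n∣m*n k) ⟩
  m / n + k * n / n    ≡⟨ cong₂ _+_ (m<n⇒m/n≡0 m<n) (m*n/n≡m k n) ⟩
  k                    ∎
  where open ≡-Reasoning

module LastPairMap (r′ t : ℕ) where

  r T s : ℕ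
  r = suc r′
  T = suc t
  s = t * r + 1

  need : ℕ → ℕ
  need zero    = 0
  need (suc p) = suc (suc p * t)

  ⌈ps/r⌉≡need : ∀ {p} → p ≤ r → ⌈ p * s / r ⌉ ≡ need p
  ⌈ps/r⌉≡need {zero}  _         = m<n⇒m/n≡0 (n<1+n r′)
  ⌈ps/r⌉≡need {suc p} (s≤s p≤r′) =
    trans (cong (_/ r) (lemma p t r′)) ([m+kn]/n≡k (need (suc p)) r (s≤s p≤r′))
    where
    lemma : ∀ p t r′ → suc p * (t * suc r′ + 1) + r′ ≡ p + suc (suc p * t) * suc r′
    lemma = solve-∀

  -- RCond and LastQ with ⌈ p s / r ⌉ replaced by need p.
  RPair : Pair → Set
  RPair (p , v) = p ≤ r × need p ≤ v

  QLastPair : Pair → Set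
  QLastPair (p , v) = p ≤ r × ((p ≡ r) ⊎ ((p < r) × ((v ≡ 0) ⊎ (need p ≤ v))))

  fromRPair : ∀ {p v} → RPair (p , v) → (p ≤ r) × (⌈ p * s / r ⌉ ≤ v)
  fromRPair (p≤r , need≤v) = p≤r , subst (_≤ _) (sym (⌈ps/r⌉≡need p≤r)) need≤v

  toRPair : ∀ {p v} → (p ≤ r) × (⌈ p * s / r ⌉ ≤ v) → RPair (p , v)
  toRPair (p≤r , ⌈⌉≤v) = p≤r , subst (_≤ _) (⌈ps/r⌉≡need p≤r) ⌈⌉≤v

  fromQLastPair : ∀ {x} → QLastPair x → LastQ r s x
  fromQLastPair (p≤r , inj₁ p≡r)                   = p≤r , inj₁ p≡r
  fromQLastPair (p≤r , inj₂ (p<r , inj₁ v≡0))      = p≤r , inj₂ (p<r , inj₁ v≡0)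
  fromQLastPair (p≤r , inj₂ (p<r , inj₂ need≤v))   =
    p≤r , inj₂ (p<r , inj₂ (subst (_≤ _) (sym (⌈ps/r⌉≡need p≤r)) need≤v))

  toQLastPair : ∀ {x} → LastQ r s x → QLastPair x
  toQLastPair (p≤r , inj₁ p≡r)                   = p≤r , inj₁ p≡r
  toQLastPair (p≤r , inj₂ (p<r , inj₁ v≡0))      = p≤r , inj₂ (p<r , inj₁ v≡0)
  toQLastPair (p≤r , inj₂ (p<r , inj₂ ⌈⌉≤v))     =
    p≤r , inj₂ (p<r , inj₂ (subst (_≤ _) (⌈ps/r⌉≡need p≤r) ⌈⌉≤v))

  regular-QLastPair : ∀ {p v} → p ≤ r → need p ≤ v → QLastPair (p , v)
  regular-QLastPair p≤r need≤v with m≤n⇒m<n∨m≡n p≤r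
  ... | inj₁ p<r = p≤r , inj₂ (p<r , inj₂ need≤v)
  ... | inj₂ p≡r = p≤r , inj₁ p≡r

  Regular Far : Pair → Set
  Regular (p , v) = need p ≤ v
  Far     (p , v) = need p + T ≤ v

  close : ℕ → Pair
  close m = suc (m / T) , need (suc (m / T)) + m % T

  closeIndex : Pair → ℕ
  closeIndex (p , w) = w ∸ need p + pred p * T

  deficient : ℕ → Pair
  deficient m with m <? r′
  ... | yes _ = suc m , 0
  ... | no  _ = r , m ∸ r′

  deficientIndex : Pair → ℕ
  deficientIndex (p , v) = pred p + v

  raise : Pair → Pair
  raise (p , v) with need p ≤? v
  ... | yes _ = p , v + T
  ... | no  _ = close (deficientIndex (p , v))

  lower : Pair → Pair
  lower (p , w) with need p + T ≤? w
  ... | yes _ = p , w ∸ T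
  ... | no  _ = deficient (closeIndex (p , w))

  raise-regular : ∀ {p v} → Regular (p , v) → raise (p , v) ≡ (p , v + T)
  raise-regular {p} {v} reg with need p ≤? v
  ... | yes _   = refl
  ... | no ¬reg = contradiction reg ¬reg

  raise-deficient : ∀ {x} → ¬ Regular x → raise x ≡ close (deficientIndex x)
  raise-deficient {p , v} ¬reg with need p ≤? v
  ... | yes reg = contradiction reg ¬reg
  ... | no _    = refl

  lower-far : ∀ {p w} → Far (p , w) → lower (p , w) ≡ (p , w ∸ T)
  lower-far {p} {w} far with need p + T ≤? w
  ... | yes _   = refl
  ... | no ¬far = contradiction far ¬far

  lower-close : ∀ {y} → ¬ Far y → lower y ≡ deficient (closeIndex y)
  lower-close {p , w} ¬far with need p + T ≤? w
  ... | yes far = contradiction far ¬far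
  ... | no _    = refl

  ¬Far⇒∸need<T : ∀ {p w} → ¬ Far (p , w) → w ∸ need p < T
  ¬Far⇒∸need<T {p} {w} ¬far = m<n+o⇒m∸n<o w (need p) (≰⇒> ¬far)

  closeIndex-close : ∀ m → closeIndex (close m) ≡ m
  closeIndex-close m = begin
    need (suc (m / T)) + m % T ∸ need (suc (m / T)) + m / T * T
      ≡⟨ cong (_+ m / T * T) (m+n∸m≡n (need (suc (m / T))) (m % T)) ⟩
    m % T + m / T * T
      ≡⟨ m≡m%n+[m/n]*n m T ⟨
    m ∎
    where open ≡-Reasoning

  close-closeIndex : ∀ {q w} → need (suc q) ≤ w → ¬ Far (suc q , w) →
                     close (closeIndex (suc q , w)) ≡ (suc q , w)
  close-closeIndex {q} {w} need≤w ¬far =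
    trans (cong₂ (λ a b → suc a , need (suc a) + b) ([m+kn]/n≡k q T j<T) [m+kn]%T≡j)
          (cong (suc q ,_) (m+[n∸m]≡n need≤w))
    where
    j<T : w ∸ need (suc q) < T
    j<T = ¬Far⇒∸need<T {suc q} ¬far
    [m+kn]%T≡j : (w ∸ need (suc q) + q * T) % T ≡ w ∸ need (suc q)
    [m+kn]%T≡j = trans ([m+kn]%n≡m%n (w ∸ need (suc q)) q T) (m<n⇒m%n≡m {n = T} j<T)

  close-¬Far : ∀ m → ¬ Far (close m)
  close-¬Far m far = <⇒≱ (m%n<n m T) (+-cancelˡ-≤ (need (suc (m / T))) T (m % T) far)

  close-RPair : ∀ {m} → m < r * T → RPair (close m)
  close-RPair {m} m<rT = m<n*o⇒m/o<n m<rT , m≤m+n (need (suc (m / T))) (m % T)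

  closeIndex-< : ∀ {q w} → suc q ≤ r → ¬ Far (suc q , w) → closeIndex (suc q , w) < r * T
  closeIndex-< {q} {w} q<r ¬far = begin-strict
    w ∸ need (suc q) + q * T  <⟨ +-monoˡ-< (q * T) (¬Far⇒∸need<T {suc q} ¬far) ⟩
    T + q * T                 ≤⟨ *-monoˡ-≤ T q<r ⟩
    r * T                     ∎
    where open ≤-Reasoning

  total-close : ∀ m → total (close m) ≡ suc m + T
  total-close m = begin
    suc q + (need (suc q) + j)  ≡⟨ lemma q j t ⟩
    suc (j + q * T) + T         ≡⟨ cong (λ k → suc k + T) (m≡m%n+[m/n]*n m T) ⟨
    suc m + T                   ∎
    where
    open ≡-Reasoning
    q = m / T
    j = m % T
    lemma : ∀ q j t → suc q + (suc (suc q * t) + j) ≡ suc (j + q * suc t) + suc t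
    lemma = solve-∀

  deficient-QLastPair : ∀ m → QLastPair (deficient m)
  deficient-QLastPair m with m <? r′
  ... | yes m<r′ = s≤s (<⇒≤ m<r′) , inj₂ (s≤s m<r′ , inj₁ refl)
  ... | no  _    = ≤-refl , inj₁ refl

  deficient-positive : ∀ m → 1 ≤ proj₁ (deficient m)
  deficient-positive m with m <? r′
  ... | yes _ = s≤s z≤n
  ... | no  _ = s≤s z≤n

  deficient-¬Regular : ∀ {m} → m < r * T → ¬ Regular (deficient m)
  deficient-¬Regular {m} m<rT with m <? r′
  ... | yes _ = λ ()
  ... | no  _ = <⇒≱ (s≤s (m≤n+o⇒m∸n≤o m r′ (≤-pred (subst (m <_) (*-suc r t) m<rT))))

  deficientIndex-deficient : ∀ m → deficientIndex (deficient m) ≡ m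
  deficientIndex-deficient m with m <? r′
  ... | yes _    = +-identityʳ m
  ... | no  m≮r′ = m+[n∸m]≡n (≮⇒≥ m≮r′)

  deficient-deficientIndex : ∀ {x} → QLastPair x → ¬ Regular x → deficient (deficientIndex x) ≡ x
  deficient-deficientIndex {zero , v}  _ ¬reg = contradiction z≤n ¬reg
  deficient-deficientIndex {suc _ , v} (_ , inj₁ refl) _ with r′ + v <? r′
  ... | yes r′+v<r′ = contradiction r′+v<r′ (m+n≮m r′ v)
  ... | no  _       = cong (r ,_) (m+n∸m≡n r′ v)
  deficient-deficientIndex {suc p , v} (_ , inj₂ (_ , inj₂ reg)) ¬reg = contradiction reg ¬reg
  deficient-deficientIndex {suc p , .0} (_ , inj₂ (s≤s p<r′ , inj₁ refl)) _ with p + 0 <? r′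
  ... | yes _     = cong (λ k → suc k , 0) (+-identityʳ p)
  ... | no  p≮r′  = contradiction (subst (_< r′) (sym (+-identityʳ p)) p<r′) p≮r′

  deficientIndex-< : ∀ {x} → QLastPair x → ¬ Regular x → deficientIndex x < r * T
  deficientIndex-< {zero , v}  _ ¬reg = contradiction z≤n ¬reg
  deficientIndex-< {suc _ , v} (_ , inj₁ refl) ¬reg =
    subst (r′ + v <_) (sym (*-suc r t)) (s≤s (+-monoʳ-≤ r′ (≤-pred (≰⇒> ¬reg))))
  deficientIndex-< {suc p , .0} (_ , inj₂ (p<r , inj₁ refl)) _ =
    ≤-trans (subst (_< r) (sym (+-identityʳ p)) (<-trans (n<1+n p) p<r)) (m≤m*n r T)
  deficientIndex-< {suc _ , _} (_ , inj₂ (_ , inj₂ reg)) ¬reg = contradiction reg ¬reg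

  raise-RPair : ∀ {x} → QLastPair x → RPair (raise x)
  raise-RPair {p , v} q with need p ≤? v
  ... | yes reg  = proj₁ q , ≤-trans reg (m≤m+n v T)
  ... | no  ¬reg = close-RPair (deficientIndex-< q ¬reg)

  lower-QLastPair : ∀ {y} → RPair y → QLastPair (lower y)
  lower-QLastPair {p , w} (p≤r , _) with need p + T ≤? w
  ... | yes far = regular-QLastPair p≤r (m+n≤o⇒m≤o∸n (need p) far)
  ... | no  _   = deficient-QLastPair _

  lower-raise : ∀ {x} → QLastPair x → lower (raise x) ≡ x
  lower-raise {p , v} q with need p ≤? v
  ... | yes reg = trans (lower-far (+-monoˡ-≤ T reg)) (cong (p ,_) (m+n∸n≡m v T))
  ... | no ¬reg = begin
    lower (close m)                   ≡⟨ lower-close {close m} (close-¬Far m) ⟩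
    deficient (closeIndex (close m))  ≡⟨ cong deficient (closeIndex-close m) ⟩
    deficient m                       ≡⟨ deficient-deficientIndex q ¬reg ⟩
    (p , v)                           ∎
    where
    open ≡-Reasoning
    m = deficientIndex (p , v)

  raise-lower : ∀ {y} → RPair y → 1 ≤ proj₁ y → raise (lower y) ≡ y
  raise-lower {suc q , w} (q<r , need≤w) _ with need (suc q) + T ≤? w
  ... | yes far = trans (raise-regular (m+n≤o⇒m≤o∸n (need (suc q)) far))
                        (cong (suc q ,_) (m∸n+n≡m (≤-trans (m≤n+m T (need (suc q))) far)))
  ... | no ¬far = begin
    raise (deficient m)
      ≡⟨ raise-deficient {deficient m} (deficient-¬Regular (closeIndex-< q<r ¬far)) ⟩
    close (deficientIndex (deficient m))  ≡⟨ cong close (deficientIndex-deficient m) ⟩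
    close m                               ≡⟨ close-closeIndex need≤w ¬far ⟩
    (suc q , w)                           ∎
    where
    open ≡-Reasoning
    m = closeIndex (suc q , w)

  raise-injective : ∀ {x y} → QLastPair x → QLastPair y → raise x ≡ raise y → x ≡ y
  raise-injective qx qy eq = trans (sym (lower-raise qx)) (trans (cong lower eq) (lower-raise qy))

  raise-positive : ∀ {x} → 1 ≤ proj₁ x → 1 ≤ proj₁ (raise x)
  raise-positive {p , v} 1≤p with need p ≤? v
  ... | yes _ = 1≤p
  ... | no  _ = s≤s z≤n

  lower-positive : ∀ {y} → 1 ≤ proj₁ y → 1 ≤ proj₁ (lower y)
  lower-positive {p , w} 1≤p with need p + T ≤? w
  ... | yes _ = 1≤p
  ... | no  _ = deficient-positive _

  total-raise : ∀ x → total (raise x) ≡ total x + T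
  total-raise (p , v) with need p ≤? v
  ... | yes _    = sym (+-assoc p v T)
  ... | no  ¬reg with p
  ...   | zero  = contradiction z≤n ¬reg
  ...   | suc p = total-close (p + v)

  raiseLast : Pair → Fact → Fact
  raiseLast x []       = raise x ∷ []
  raiseLast x (y ∷ ys) = x ∷ raiseLast y ys

  size-raiseLast : ∀ x xs → size (raiseLast x xs) ≡ size (x ∷ xs) + T
  size-raiseLast x []       = begin
    total (raise x) + 0  ≡⟨ +-identityʳ _ ⟩
    total (raise x)      ≡⟨ total-raise x ⟩
    total x + T          ≡⟨ cong (_+ T) (+-identityʳ (total x)) ⟨
    total x + 0 + T      ∎
    where open ≡-Reasoning
  size-raiseLast x (y ∷ ys) =
    trans (cong (total x +_) (size-raiseLast y ys)) (sym (+-assoc (total x) (size (y ∷ ys)) T))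

  raiseLast-ValidTail : ∀ {x xs} → ValidTail (x ∷ xs) → ValidTail (raiseLast x xs)
  raiseLast-ValidTail {xs = []}         1≤p               = raise-positive 1≤p
  raiseLast-ValidTail {xs = _ ∷ []}     (1≤p , 1≤v , 1≤p′) = 1≤p , 1≤v , raise-positive 1≤p′
  raiseLast-ValidTail {xs = _ ∷ _ ∷ _}  (1≤p , 1≤v , tail) = 1≤p , 1≤v , raiseLast-ValidTail tail

  raiseLast-ValidFact : ∀ {x xs} → ValidFact (x ∷ xs) → ValidFact (raiseLast x xs)
  raiseLast-ValidFact {x} {[]}         _            =
    subst (1 ≤_) (sym (total-raise x)) (≤-trans (s≤s z≤n) (m≤n+m T (total x)))
  raiseLast-ValidFact {xs = _ ∷ []}    (1≤v , tail) = 1≤v , raiseLast-ValidTail tail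
  raiseLast-ValidFact {xs = _ ∷ _ ∷ _} (1≤v , tail) = 1≤v , raiseLast-ValidTail tail

  raiseLast-RCond : ∀ {x xs} → QCond r s (x ∷ xs) → RCond r s (raiseLast x xs)
  raiseLast-RCond {xs = []}     q             = fromRPair (raise-RPair (toQLastPair q)) ∷ []
  raiseLast-RCond {xs = _ ∷ _}  (rx ∷ [] , q) = rx ∷ raiseLast-RCond q

  []≢raiseLast : ∀ x xs → [] ≢ raiseLast x xs
  []≢raiseLast x []      ()
  []≢raiseLast x (_ ∷ _) ()

  raiseLast-injective : ∀ {x xs y ys} → QCond r s (x ∷ xs) → QCond r s (y ∷ ys) →
                        raiseLast x xs ≡ raiseLast y ys → x ∷ xs ≡ y ∷ ys
  raiseLast-injective {xs = []}    {ys = []}    qx qy eq =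
    cong (_∷ []) (raise-injective (toQLastPair qx) (toQLastPair qy) (∷-injectiveˡ eq))
  raiseLast-injective {xs = []}    {ys = _ ∷ _} _ _ eq = contradiction (∷-injectiveʳ eq) ([]≢raiseLast _ _)
  raiseLast-injective {xs = _ ∷ _} {ys = []}    _ _ eq = contradiction (sym (∷-injectiveʳ eq)) ([]≢raiseLast _ _)
  raiseLast-injective {xs = _ ∷ _} {ys = _ ∷ _} (_ , qx) (_ , qy) eq =
    cong₂ _∷_ (∷-injectiveˡ eq) (raiseLast-injective qx qy (∷-injectiveʳ eq))

  raiseLast-onto : ∀ {y ys} → ValidTail (y ∷ ys) → RCond r s (y ∷ ys) →
                   Σ Pair λ x → Σ Fact λ xs →
                     ValidTail (x ∷ xs) × QCond r s (x ∷ xs) × raiseLast x xs ≡ y ∷ ys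
  raiseLast-onto {y} {[]} 1≤p (ry ∷ []) =
    lower y , [] , lower-positive 1≤p , fromQLastPair (lower-QLastPair (toRPair ry)) ,
    cong (_∷ []) (raise-lower (toRPair ry) 1≤p)
  raiseLast-onto {y} {_ ∷ _} (1≤p , 1≤v , tail) (ry ∷ rs) with raiseLast-onto tail rs
  ... | x , xs , vt , q , eq = y , x ∷ xs , (1≤p , 1≤v , vt) , (ry ∷ [] , q) , cong (y ∷_) eq

  column-RCond : ∀ v → RCond r s (column v)
  column-RCond zero    = []
  column-RCond (suc v) = fromRPair (z≤n , z≤n) ∷ []

  column-QCond : ∀ v → QCond r s (column v)
  column-QCond zero    = tt
  column-QCond (suc v) = fromQLastPair (regular-QLastPair z≤n z≤n)

  raiseCode : Maybe Fact → Fact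
  raiseCode nothing         = column t
  raiseCode (just [])       = column T
  raiseCode (just (x ∷ xs)) = raiseLast x xs

  raiseCode-column : ∀ c → raiseCode (just (column c)) ≡ column (c + T)
  raiseCode-column zero    = refl
  raiseCode-column (suc c) = cong (_∷ []) (raise-regular {0} {suc c} z≤n)

  size-raiseCode : ∀ c → size (raiseCode c) ≡ codeSize c + t
  size-raiseCode nothing         = size-column t
  size-raiseCode (just [])       = size-column T
  size-raiseCode (just (x ∷ xs)) = trans (size-raiseLast x xs) (+-suc (size (x ∷ xs)) t)

  raiseCode-ValidCode : ∀ {c} → ValidCode (QCond r s) c → ValidCode (RCond r s) (just (raiseCode c))
  raiseCode-ValidCode {nothing}       _        = column-ValidFact t , column-RCond t
  raiseCode-ValidCode {just []}       _        = column-ValidFact T , column-RCond T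
  raiseCode-ValidCode {just (_ ∷ _)}  (vf , q) = raiseLast-ValidFact vf , raiseLast-RCond q

  raiseCode-injective : ∀ {n c c′} → Code (QCond r s) n c → Code (QCond r s) n c′ →
                        raiseCode c ≡ raiseCode c′ → c ≡ c′
  raiseCode-injective {c = nothing}       {nothing}       _ _ _ = refl
  raiseCode-injective {c = nothing}       {just _}        (_ , sz) (_ , sz′) _ =
    contradiction (trans sz′ (sym sz)) λ ()
  raiseCode-injective {c = just _}        {nothing}       (_ , sz) (_ , sz′) _ =
    contradiction (trans sz (sym sz′)) λ ()
  raiseCode-injective {c = just []}       {just []}       _ _ _ = refl
  raiseCode-injective {c = just []}       {just (_ ∷ _)}  (_ , sz) ((vf , _) , sz′) _ =
    contradiction (suc-injective (trans sz′ (sym sz))) (≢-sym (<⇒≢ (ValidFact⇒size-pos vf)))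
  raiseCode-injective {c = just (_ ∷ _)}  {just []}       ((vf , _) , sz) (_ , sz′) _ =
    contradiction (suc-injective (trans sz (sym sz′))) (≢-sym (<⇒≢ (ValidFact⇒size-pos vf)))
  raiseCode-injective {c = just (_ ∷ _)}  {just (_ ∷ _)}  ((_ , q) , _) ((_ , q′) , _) eq =
    cong just (raiseLast-injective q q′ eq)

  codeSize-raiseCode⁻¹ : ∀ c {n gs} → raiseCode c ≡ gs → size gs ≡ n + t → codeSize c ≡ n
  codeSize-raiseCode⁻¹ c {n} eq sz =
    +-cancelʳ-≡ t (codeSize c) n (trans (sym (size-raiseCode c)) (trans (cong size eq) sz))

  raiseCode-onto-column : ∀ {n v} → v ≡ n + t →
                          Σ (Maybe Fact) λ c → Code (QCond r s) n c × raiseCode c ≡ column v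
  raiseCode-onto-column {zero}  refl = nothing , (tt , refl) , refl
  raiseCode-onto-column {suc n} refl =
    just (column n) , ((column-ValidFact n , column-QCond n) , cong suc (size-column n)) ,
    trans (raiseCode-column n) (cong column (+-suc n t))

  raiseCode-onto : ∀ {n gs} → ValidFact gs → RCond r s gs → size gs ≡ n + t →
                   Σ (Maybe Fact) λ c → Code (QCond r s) n c × raiseCode c ≡ gs
  raiseCode-onto {gs = []}                   _ _ sz = raiseCode-onto-column sz
  raiseCode-onto {gs = (zero , suc v) ∷ []}  _ _ sz = raiseCode-onto-column (trans (sym (+-identityʳ (suc v))) sz)
  raiseCode-onto {gs = (suc p , v) ∷ []} _ rg sz with raiseLast-onto (s≤s z≤n) rg
  ... | x , xs , vt , q , eq =
    just (x ∷ xs) , ((ValidTail⇒ValidFact vt , q) , codeSize-raiseCode⁻¹ (just (x ∷ xs)) eq sz) , eq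
  raiseCode-onto {gs = y ∷ z ∷ zs} (1≤v , tail) (ry ∷ rs) sz with raiseLast-onto tail rs
  ... | x , xs , vt , q , eq =
    just (y ∷ x ∷ xs) ,
    (((1≤v , vt) , (ry ∷ [] , q)) , codeSize-raiseCode⁻¹ (just (y ∷ x ∷ xs)) (cong (y ∷_) eq) sz) ,
    cong (y ∷_) eq

  raiseCodeBijection : ∀ n → CodeBijection (QCond r s) n (RCond r s) (n + t + 1)
  raiseCodeBijection n = record
    { to           = raiseCode
    ; to-code      = λ {c} (vc , sz) → raiseCode-ValidCode vc , suc-size c sz
    ; to-injective = raiseCode-injective
    ; to-onto      = λ ((vg , rg) , sz) → raiseCode-onto vg rg (suc-injective (trans sz (+-comm (n + t) 1)))
    }
    where
    suc-size : ∀ c → codeSize c ≡ n → suc (size (raiseCode c)) ≡ n + t + 1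
    suc-size c refl = trans (cong suc (size-raiseCode c)) (+-comm 1 (codeSize c + t))

proposition6 : (r s t : ℕ) → .{{_ : NonZero r}} → .{{_ : NonZero s}} →
    Coprime r s → s ≡ t * r + 1 →
    (n : ℕ) → Bijection (InQ r s n) (InR r s (n + t + 1))
-- Coprimality is automatic once s = t r + 1.
proposition6 (suc r′) .(t * suc r′ + 1) t _ refl n =
  CodeBijection⇒Bijection (m+1+n≢0 (n + t)) (LastPairMap.raiseCodeBijection r′ t n)
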